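{- Let $n=\prod_{i=1}^k p_i^{\alpha_i}$ be the prime factorization of an integer $n>1$ with $\alpha_i>0$ for all $i$, and let $a\in GP(\mathbb Z_n)\setminus P(\mathbb Z_n)$. If $a$ is a unit of $\mathbb Z_n$, then $a_u=1$. If $a$ is not a unit of $\mathbb Z_n$, then $a_u=b^{\varphi(n/b)}$ (computed in $\mathbb Z_n$), where $b=\prod_{j:\ a\equiv 0 \pmod{p_j^{\alpha_j}}} p_j^{\alpha_j}$ and $\varphi$ is Euler's totient function.
   Context: On $\mathbb Z_n$ define the partial order $\leq$ by: $a\leq b$ iff $a=b$ or $a\equiv ab\pmod n$; write $a<b$ for $a\leq b$, $a\neq b$. $GP(\mathbb Z_n)$ is the set of $a\in\mathbb Z_n$ with $a^m=a$ for some integer $m\geq2$, and $P(\mathbb Z_n)=\{a: a^2=a\}$. For $a\in GP(\mathbb Z_n)\setminus P(\mathbb Z_n)$, the upper covering projection $a_u$ is the unique element of $GP(\mathbb Z_n)$ that is an upper cover of $a$ in the poset $(GP(\mathbb Z_n),\leq)$; it is known to exist, to be a projection, and to satisfy: for $x\in GP(\mathbb Z_n)$, $a<x$ iff $a_u\leq x$ (i.e. $a_u$ is the least element of $\{x\in GP(\mathbb Z_n): a<x\}$). -}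

module Defs where

open import Data.Nat using (ℕ; zero; suc; _+_; _*_; _^_; _≤_; _<_; NonZero)
open import Data.Nat.DivMod using (_%_; _/_)
open import Data.Nat.Divisibility using (_∣_; _∣?_)
open import Data.Nat.GCD using (gcd)
open import Data.Nat.Properties using (_≟_)
open import Data.Fin using (Fin)
open import Data.List using (List; length; filter; map; upTo)
open import Data.Product using (Σ; _×_; ∃)
open import Data.Empty using (⊥)
open import Relation.Nullary using (¬_; yes; no)
open import Relation.Binary.PropositionalEquality using (_≡_; _≢_)
open import Data.Sum using (_⊎_)

-- Elements of ℤ_n are represented by residues a ∈ ℕ with a < n.

_≼[_]_ : ℕ → (n : ℕ) → .{{NonZero n}} → ℕ → Set
a ≼[ n ] b = (a ≡ b) ⊎ (a % n ≡ (a * b) % n)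

_≺[_]_ : ℕ → (n : ℕ) → .{{NonZero n}} → ℕ → Set
a ≺[ n ] b = (a ≼[ n ] b) × (a ≢ b)

GP : (n : ℕ) → .{{NonZero n}} → ℕ → Set
GP n a = (a < n) × Σ ℕ (λ m → (2 ≤ m) × ((a ^ m) % n ≡ a % n))

P : (n : ℕ) → .{{NonZero n}} → ℕ → Set
P n a = (a < n) × ((a * a) % n ≡ a % n)

Unit : (n : ℕ) → .{{NonZero n}} → ℕ → Set
Unit n a = Σ ℕ (λ c → (a * c) % n ≡ 1 % n)

IsUpperCover : (n : ℕ) → .{{NonZero n}} → ℕ → ℕ → Set
IsUpperCover n a x =
  GP n x × (a ≺[ n ] x) ×
  ((y : ℕ) → GP n y → a ≺[ n ] y → y ≺[ n ] x → ⊥)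

φ : ℕ → ℕ
φ m = length (filter (λ i → gcd i m ≟ 1) (map suc (upTo m)))

∏ : (k : ℕ) → (Fin k → ℕ) → ℕ
∏ zero f = 1
∏ (suc k) f = f Fin.zero * ∏ k (λ i → f (Fin.suc i))

bFactor : (k : ℕ) → (Fin k → ℕ) → (Fin k → ℕ) → ℕ → ℕ
bFactor k p α a = ∏ k (λ j → sel (p j ^ α j))
  where
  sel : ℕ → ℕ
  sel q with q ∣? a
  ... | yes _ = q
  ... | no  _ = 1

-- natural-number division, total (the divisor is never 0 where used)
_div_ : ℕ → ℕ → ℕ
m div zero = 0
m div (suc d) = m / suc d

-- "a_u = t": t is the (unique) upper cover of a in (GP(ℤ_n), ≤)
UpperCoverIs : (n : ℕ) → .{{NonZero n}} → ℕ → ℕ → Set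
UpperCoverIs n a t = IsUpperCover n a t × ((x : ℕ) → IsUpperCover n a x → x ≡ t)

-- Write n = b·c with b the product of the prime powers of n that divide a, and c the rest.
-- An element of GP(ℤₙ) divisible by a prime p is divisible by the whole power of p in n, so a is
-- a unit mod c; under ℤₙ ≅ ℤ_b × ℤ_c the element a is (0, u). Cancelling u, the y with a < y are
-- exactly those with y ≡ 1 (mod c), and the least of them is the projection e = (0, 1). Euler's
-- theorem gives b^φ(c) ≡ 1 (mod c), so e = b^φ(c) mod n; for a unit, b = 1 and e = 1.
module Submission where

open import Defs
open import Data.Nat
open import Data.Nat.Properties
open import Data.Nat.DivMod
  using (_%_; _/_; m≡m%n+[m/n]*n; %-distribˡ-*; %-remove-+ʳ; m∣n⇒o%n%m≡o%m; m<n⇒m%n≡m; m%n<n; m%n%n≡m%n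
        ; m*n/n≡m; n%1≡0)
open import Data.Nat.Divisibility
open import Data.Nat.GCD using (gcd)
open import Data.Nat.Coprimality as Coprime
  using (Coprime; coprime-divisor; 1-coprimeTo; ¬0-coprimeTo-2+; gcd≡1⇒coprime; coprime⇒gcd≡1)
open import Data.Nat.Primality using (Prime; prime⇒irreducible; prime⇒nonZero; prime⇒nonTrivial)
open import Data.Nat.ListAction using (product)
open import Data.Nat.ListAction.Properties using (product-↭)
open import Data.Fin using (Fin)
import Data.Fin.Properties as Finₚ
open import Data.List using (List; []; _∷_; _++_; length; filter; map; upTo)
open import Data.List.Properties using (length-map; length-++)
open import Data.List.Membership.Propositional using (_∈_)
open import Data.List.Membership.Propositional.Properties
  using (∈-∃++; ∈-++⁻; ∈-++⁺ˡ; ∈-++⁺ʳ; ∈-filter⁺; ∈-filter⁻; ∈-map⁺; ∈-map⁻; ∈-upTo⁺; ∈-upTo⁻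
        ; ∈-length)
open import Data.List.Relation.Unary.Any using (here; there)
open import Data.List.Relation.Unary.All as All using (All; []; _∷_)
open import Data.List.Relation.Unary.All.Properties as All using ()
open import Data.List.Relation.Unary.AllPairs using ([]; _∷_)
open import Data.List.Relation.Unary.Unique.Propositional using (Unique)
import Data.List.Relation.Unary.Unique.Propositional.Properties as Unique
open import Data.List.Relation.Binary.Permutation.Propositional using (_↭_; ↭-refl; ↭-sym; ↭-trans; prep)
open import Data.List.Relation.Binary.Permutation.Propositional.Properties using (shift)
open import Algebra.Properties.CommutativeSemigroup *-commutativeSemigroup using (interchange)
open import Function using (_∘_)
open import Data.Sum using (inj₁; inj₂)
open import Data.Product using (_×_; _,_; proj₁; proj₂)
open import Data.Empty using (⊥; ⊥-elim)
open import Relation.Nullary using (¬_; yes; no)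
open import Relation.Binary.PropositionalEquality

infix 4 _≡_mod_

_≡_mod_ : ℕ → ℕ → (n : ℕ) → .{{NonZero n}} → Set
x ≡ y mod n = x % n ≡ y % n

module _ {n : ℕ} .{{_ : NonZero n}} where

  *-cong-≡mod : ∀ {x x′ y y′} → x ≡ x′ mod n → y ≡ y′ mod n → x * y ≡ x′ * y′ mod n
  *-cong-≡mod {x} {x′} {y} {y′} x≡x′ y≡y′ = begin
    (x * y) % n               ≡⟨ %-distribˡ-* x y n ⟩
    ((x % n) * (y % n)) % n   ≡⟨ cong₂ (λ u v → (u * v) % n) x≡x′ y≡y′ ⟩
    ((x′ % n) * (y′ % n)) % n ≡⟨ %-distribˡ-* x′ y′ n ⟨
    (x′ * y′) % n             ∎
    where open ≡-Reasoning

  ∣∧∣⇒≡mod : ∀ {x y} → n ∣ x → n ∣ y → x ≡ y mod n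
  ∣∧∣⇒≡mod {x} {y} n∣x n∣y = trans (n∣m⇒m%n≡0 x n n∣x) (sym (n∣m⇒m%n≡0 y n n∣y))

  ≡mod∧<⇒≡ : ∀ {x y} → x < n → y < n → x ≡ y mod n → x ≡ y
  ≡mod∧<⇒≡ x<n y<n x≡y = trans (sym (m<n⇒m%n≡m x<n)) (trans x≡y (m<n⇒m%n≡m y<n))

  ≡mod⇒∣∸ : ∀ {x y} → x ≡ y mod n → n ∣ x ∸ y
  ≡mod⇒∣∸ {x} {y} x≡y = divides (x / n ∸ y / n) (begin
    x ∸ y                                         ≡⟨ cong₂ _∸_ (m≡m%n+[m/n]*n x n) (m≡m%n+[m/n]*n y n) ⟩
    (x % n + (x / n) * n) ∸ (y % n + (y / n) * n) ≡⟨ cong (λ r → (r + (x / n) * n) ∸ (y % n + (y / n) * n)) x≡y ⟩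
    (y % n + (x / n) * n) ∸ (y % n + (y / n) * n) ≡⟨ [m+n]∸[m+o]≡n∸o (y % n) ((x / n) * n) ((y / n) * n) ⟩
    (x / n) * n ∸ (y / n) * n                     ≡⟨ *-distribʳ-∸ n (x / n) (y / n) ⟨
    (x / n ∸ y / n) * n                           ∎)
    where open ≡-Reasoning

  ∣∸⇒≡mod : ∀ {x y} → y ≤ x → n ∣ x ∸ y → x ≡ y mod n
  ∣∸⇒≡mod {x} {y} y≤x n∣x∸y = trans (cong (_% n) (sym (m+[n∸m]≡n y≤x))) (%-remove-+ʳ y n∣x∸y)

  ≡mod⇒∣∣-∣ : ∀ {x y} → x ≡ y mod n → n ∣ ∣ x - y ∣
  ≡mod⇒∣∣-∣ {x} {y} x≡y with ≤-total y x
  ... | inj₁ y≤x = subst (n ∣_) (sym (m≤n⇒∣n-m∣≡n∸m y≤x)) (≡mod⇒∣∸ x≡y)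
  ... | inj₂ x≤y = subst (n ∣_) (sym (m≤n⇒∣m-n∣≡n∸m x≤y)) (≡mod⇒∣∸ (sym x≡y))

  ∣∣-∣⇒≡mod : ∀ {x y} → n ∣ ∣ x - y ∣ → x ≡ y mod n
  ∣∣-∣⇒≡mod {x} {y} n∣∣x-y∣ with ≤-total y x
  ... | inj₁ y≤x = ∣∸⇒≡mod y≤x (subst (n ∣_) (m≤n⇒∣n-m∣≡n∸m y≤x) n∣∣x-y∣)
  ... | inj₂ x≤y = sym (∣∸⇒≡mod x≤y (subst (n ∣_) (m≤n⇒∣m-n∣≡n∸m x≤y) n∣∣x-y∣))

≡mod-divisor : ∀ {d n} .{{_ : NonZero d}} .{{_ : NonZero n}} {x y} → d ∣ n → x ≡ y mod n → x ≡ y mod d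
≡mod-divisor {d} {n} {x} {y} d∣n x≡y =
  trans (sym (m∣n⇒o%n%m≡o%m d n x d∣n)) (trans (cong (_% d) x≡y) (m∣n⇒o%n%m≡o%m d n y d∣n))

coprime-∣ˡ : ∀ {d x y} → d ∣ x → Coprime x y → Coprime d y
coprime-∣ˡ d∣x x⊥y (e∣d , e∣y) = x⊥y (∣-trans e∣d d∣x , e∣y)

coprime-*ˡ : ∀ {x y c} → Coprime x c → Coprime y c → Coprime (x * y) c
coprime-*ˡ {x} x⊥c y⊥c {d} (d∣xy , d∣c) = y⊥c (coprime-divisor d⊥x d∣xy , d∣c)
  where
  d⊥x : Coprime d x
  d⊥x (e∣d , e∣x) = x⊥c (e∣x , ∣-trans e∣d d∣c)

coprime-^ˡ : ∀ {x y} → Coprime x y → ∀ m → Coprime (x ^ m) y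
coprime-^ˡ {y = y} x⊥y zero = 1-coprimeTo y
coprime-^ˡ x⊥y (suc m) = coprime-*ˡ x⊥y (coprime-^ˡ x⊥y m)

coprime-^ : ∀ {x y} → Coprime x y → ∀ m l → Coprime (x ^ m) (y ^ l)
coprime-^ x⊥y m l = Coprime.sym (coprime-^ˡ (Coprime.sym (coprime-^ˡ x⊥y m)) l)

coprime-%ˡ : ∀ {x c} .{{_ : NonZero c}} → Coprime x c → Coprime (x % c) c
coprime-%ˡ {x} {c} x⊥c {d} (d∣x%c , d∣c) =
  x⊥c (subst (d ∣_) (sym (m≡m%n+[m/n]*n x c)) (∣m∣n⇒∣m+n d∣x%c (∣n⇒∣m*n (x / c) d∣c)) , d∣c)

coprime∧∣∧∣⇒*∣ : ∀ {b c z} → Coprime b c → b ∣ z → c ∣ z → b * c ∣ z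
coprime∧∣∧∣⇒*∣ {b} {c} b⊥c (divides t refl) c∣tb =
  subst (b * c ∣_) (*-comm b t)
    (*-pres-∣ (∣-refl {b}) (coprime-divisor (Coprime.sym b⊥c) (subst (c ∣_) (*-comm t b) c∣tb)))

prime∤⇒coprime : ∀ {p x} → Prime p → ¬ p ∣ x → Coprime p x
prime∤⇒coprime pp p∤x {d} (d∣p , d∣x) with prime⇒irreducible pp d∣p
... | inj₁ d≡1 = d≡1
... | inj₂ refl = ⊥-elim (p∤x d∣x)

distinct-primes⇒coprime : ∀ {p q} → Prime p → Prime q → p ≢ q → Coprime p q
distinct-primes⇒coprime {p} {q} pp pq p≢q = prime∤⇒coprime pp p∤q
  where
  p∤q : ¬ p ∣ q
  p∤q p∣q with prime⇒irreducible pq p∣q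
  ... | inj₁ p≡1 = nonTrivial⇒≢1 {{prime⇒nonTrivial pp}} p≡1
  ... | inj₂ p≡q = p≢q p≡q

chinese-remainder : ∀ {b c n} .{{_ : NonZero b}} .{{_ : NonZero c}} .{{_ : NonZero n}} {x y} →
  b * c ≡ n → Coprime b c → x ≡ y mod b → x ≡ y mod c → x ≡ y mod n
chinese-remainder refl b⊥c x≡y[b] x≡y[c] =
  ∣∣-∣⇒≡mod (coprime∧∣∧∣⇒*∣ b⊥c (≡mod⇒∣∣-∣ x≡y[b]) (≡mod⇒∣∣-∣ x≡y[c]))

*-cancelˡ-≡mod : ∀ {a c} .{{_ : NonZero c}} {u v} → Coprime a c → a * u ≡ a * v mod c → u ≡ v mod c
*-cancelˡ-≡mod {a} {c} {u} {v} a⊥c au≡av =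
  ∣∣-∣⇒≡mod (coprime-divisor (Coprime.sym a⊥c)
    (subst (c ∣_) (sym (*-distribˡ-∣-∣ a u v)) (≡mod⇒∣∣-∣ au≡av)))

module _ {a} {A : Set a} where

  ⊆∧length≡⇒↭ : ∀ {xs ys : List A} →
    Unique xs → (∀ {z} → z ∈ xs → z ∈ ys) → length xs ≡ length ys → xs ↭ ys
  ⊆∧length≡⇒↭ {[]} {[]} _ _ _ = ↭-refl
  ⊆∧length≡⇒↭ {x ∷ xs} {ys} (x∉xs ∷ xs!) xs⊆ys |xs|≡|ys| with ∈-∃++ (xs⊆ys (here refl))
  ... | l , r , refl = ↭-trans (prep x (⊆∧length≡⇒↭ xs! xs⊆l++r |xs|≡|l++r|)) (↭-sym (shift x l r))
    where
    xs⊆l++r : ∀ {z} → z ∈ xs → z ∈ l ++ r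
    xs⊆l++r {z} z∈xs with ∈-++⁻ l (xs⊆ys (there z∈xs))
    ... | inj₁ z∈l = ∈-++⁺ˡ z∈l
    ... | inj₂ (here z≡x) = ⊥-elim (All.lookup x∉xs z∈xs (sym z≡x))
    ... | inj₂ (there z∈r) = ∈-++⁺ʳ l z∈r
    |xs|≡|l++r| : length xs ≡ length (l ++ r)
    |xs|≡|l++r| = suc-injective (begin
      suc (length xs)           ≡⟨ |xs|≡|ys| ⟩
      length (l ++ x ∷ r)       ≡⟨ length-++ l ⟩
      length l + suc (length r) ≡⟨ +-suc (length l) (length r) ⟩
      suc (length l + length r) ≡⟨ cong suc (length-++ l) ⟨
      suc (length (l ++ r))     ∎)
      where open ≡-Reasoning

  map⁺-injectiveOn : ∀ {b} {B : Set b} {f : A → B} {xs} →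
    (∀ {x y} → x ∈ xs → y ∈ xs → f x ≡ f y → x ≡ y) → Unique xs → Unique (map f xs)
  map⁺-injectiveOn {xs = []} _ [] = []
  map⁺-injectiveOn {xs = x ∷ xs} f-inj (x∉xs ∷ xs!) =
    All.map⁺ (All.tabulate λ y∈xs fx≡fy → All.lookup x∉xs y∈xs (f-inj (here refl) (there y∈xs) fx≡fy))
    ∷ map⁺-injectiveOn (λ x∈ y∈ → f-inj (there x∈) (there y∈)) xs!

coprime-product : ∀ {c} (rs : List ℕ) → (∀ {r} → r ∈ rs → Coprime r c) → Coprime (product rs) c
coprime-product {c} [] _ = 1-coprimeTo c
coprime-product (r ∷ rs) rs⊥c = coprime-*ˡ (rs⊥c (here refl)) (coprime-product rs (rs⊥c ∘ there))

product-map-*-≡mod : ∀ b c .{{_ : NonZero c}} (rs : List ℕ) →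
  product (map (λ r → (b * r) % c) rs) ≡ b ^ length rs * product rs mod c
product-map-*-≡mod b c [] = refl
product-map-*-≡mod b c (r ∷ rs) =
  trans (*-cong-≡mod (m%n%n≡m%n (b * r) c) (product-map-*-≡mod b c rs))
        (cong (_% c) (interchange b r (b ^ length rs) (product rs)))

reducedResidues : ℕ → List ℕ
reducedResidues c = filter (λ i → gcd i c ≟ 1) (map suc (upTo c))

1∈reducedResidues : ∀ c .{{_ : NonZero c}} → 1 ∈ reducedResidues c
1∈reducedResidues c =
  ∈-filter⁺ (λ i → gcd i c ≟ 1) (∈-map⁺ suc (∈-upTo⁺ (>-nonZero⁻¹ c))) (coprime⇒gcd≡1 (1-coprimeTo c))

φ>0 : ∀ c .{{_ : NonZero c}} → φ c > 0
φ>0 c = ∈-length (1∈reducedResidues c)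

module _ (c : ℕ) .{{_ : NonTrivial c}} where

  private instance
    c≢0 : NonZero c
    c≢0 = nonTrivial⇒nonZero c

  ∈-reducedResidues⁻ : ∀ {z} → z ∈ reducedResidues c → z < c × Coprime z c
  ∈-reducedResidues⁻ z∈R with ∈-filter⁻ (λ i → gcd i c ≟ 1) {xs = map suc (upTo c)} z∈R
  ... | z∈suc-upTo , gcd[z,c]≡1 with ∈-map⁻ suc z∈suc-upTo
  ... | w , w∈upTo , refl with m≤n⇒m<n∨m≡n (∈-upTo⁻ w∈upTo)
  ...   | inj₁ z<c = z<c , gcd≡1⇒coprime gcd[z,c]≡1
  ...   | inj₂ refl = ⊥-elim (nonTrivial⇒≢1 {c} (gcd≡1⇒coprime gcd[z,c]≡1 (∣-refl , ∣-refl)))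

  ∈-reducedResidues⁺ : ∀ {z} → z < c → Coprime z c → z ∈ reducedResidues c
  ∈-reducedResidues⁺ {zero} _ 0⊥c = ⊥-elim (¬0-coprimeTo-2+ 0⊥c)
  ∈-reducedResidues⁺ {suc w} z<c z⊥c =
    ∈-filter⁺ (λ i → gcd i c ≟ 1) (∈-map⁺ suc (∈-upTo⁺ (<-trans (n<1+n w) z<c))) (coprime⇒gcd≡1 z⊥c)

  reducedResidues-unique : Unique (reducedResidues c)
  reducedResidues-unique = Unique.filter⁺ (λ i → gcd i c ≟ 1) (Unique.map⁺ suc-injective (Unique.upTo⁺ c))

  -- Multiplication by b permutes the reduced residues; comparing products and cancelling them gives b^φ(c) ≡ 1.
  euler-nonTrivial : ∀ {b} → Coprime b c → b ^ φ c ≡ 1 mod c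
  euler-nonTrivial {b} b⊥c = *-cancelˡ-≡mod (coprime-product R (proj₂ ∘ ∈-reducedResidues⁻)) (begin
    (product R * b ^ length R) % c ≡⟨ cong (_% c) (*-comm (product R) (b ^ length R)) ⟩
    (b ^ length R * product R) % c ≡⟨ product-map-*-≡mod b c R ⟨
    product (map mul-b R) % c      ≡⟨ cong (_% c) (product-↭ mul-b-permutes) ⟩
    product R % c                  ≡⟨ cong (_% c) (*-identityʳ (product R)) ⟨
    (product R * 1) % c            ∎)
    where
    open ≡-Reasoning
    R : List ℕ
    R = reducedResidues c
    mul-b : ℕ → ℕ
    mul-b r = (b * r) % c
    injective : ∀ {x y} → x ∈ R → y ∈ R → mul-b x ≡ mul-b y → x ≡ y
    injective x∈R y∈R bx≡by =
      ≡mod∧<⇒≡ (proj₁ (∈-reducedResidues⁻ x∈R)) (proj₁ (∈-reducedResidues⁻ y∈R)) (*-cancelˡ-≡mod b⊥c bx≡by)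
    maps-into : ∀ {z} → z ∈ map mul-b R → z ∈ R
    maps-into z∈ with ∈-map⁻ mul-b z∈
    ... | r , r∈R , refl = ∈-reducedResidues⁺ (m%n<n (b * r) c)
      (coprime-%ˡ (coprime-*ˡ b⊥c (proj₂ (∈-reducedResidues⁻ r∈R))))
    mul-b-permutes : map mul-b R ↭ R
    mul-b-permutes =
      ⊆∧length≡⇒↭ (map⁺-injectiveOn injective reducedResidues-unique) maps-into (length-map mul-b R)

euler : ∀ c .{{_ : NonZero c}} {b} → Coprime b c → b ^ φ c ≡ 1 mod c
euler 1 {b} _ = n%1≡0 (b ^ φ 1)
euler c@(suc (suc _)) = euler-nonTrivial c

∏-cong : ∀ k {f g : Fin k → ℕ} → (∀ j → f j ≡ g j) → ∏ k f ≡ ∏ k g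
∏-cong zero _ = refl
∏-cong (suc k) f≗g = cong₂ _*_ (f≗g Fin.zero) (∏-cong k (f≗g ∘ Fin.suc))

∏-distrib-* : ∀ k (f g : Fin k → ℕ) → ∏ k f * ∏ k g ≡ ∏ k (λ j → f j * g j)
∏-distrib-* zero f g = refl
∏-distrib-* (suc k) f g =
  trans (interchange (f Fin.zero) (∏ k (f ∘ Fin.suc)) (g Fin.zero) (∏ k (g ∘ Fin.suc)))
        (cong (f Fin.zero * g Fin.zero *_) (∏-distrib-* k (f ∘ Fin.suc) (g ∘ Fin.suc)))

∣-∏ : ∀ k (f : Fin k → ℕ) j → f j ∣ ∏ k f
∣-∏ (suc k) f Fin.zero = m∣m*n (∏ k (f ∘ Fin.suc))
∣-∏ (suc k) f (Fin.suc j) = ∣n⇒∣m*n (f Fin.zero) (∣-∏ k (f ∘ Fin.suc) j)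

coprime-∏ʳ : ∀ k {x} (f : Fin k → ℕ) → (∀ j → Coprime x (f j)) → Coprime x (∏ k f)
coprime-∏ʳ zero {x} f _ = Coprime.sym (1-coprimeTo x)
coprime-∏ʳ (suc k) f x⊥f =
  Coprime.sym (coprime-*ˡ (Coprime.sym (x⊥f Fin.zero))
                          (Coprime.sym (coprime-∏ʳ k (f ∘ Fin.suc) (x⊥f ∘ Fin.suc))))

∏-∣ : ∀ k (f : Fin k → ℕ) {a} →
  (∀ i j → i ≢ j → Coprime (f i) (f j)) → (∀ j → f j ∣ a) → ∏ k f ∣ a
∏-∣ zero f _ _ = 1∣ _
∏-∣ (suc k) f pairwise f∣a = coprime∧∣∧∣⇒*∣
  (coprime-∏ʳ k (f ∘ Fin.suc) (λ j → pairwise Fin.zero (Fin.suc j) λ ()))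
  (f∣a Fin.zero)
  (∏-∣ k (f ∘ Fin.suc) (λ i j i≢j → pairwise (Fin.suc i) (Fin.suc j) (i≢j ∘ Finₚ.suc-injective))
                      (f∣a ∘ Fin.suc))

∣-part : ℕ → ℕ → ℕ
∣-part a q with q ∣? a
... | yes _ = q
... | no  _ = 1

∤-part : ℕ → ℕ → ℕ
∤-part a q with q ∣? a
... | yes _ = 1
... | no  _ = q

∣-part*∤-part : ∀ a q → ∣-part a q * ∤-part a q ≡ q
∣-part*∤-part a q with q ∣? a
... | yes _ = *-identityʳ q
... | no  _ = +-identityʳ q

∣-part∣ : ∀ a q → ∣-part a q ∣ a
∣-part∣ a q with q ∣? a
... | yes q∣a = q∣a
... | no  _ = 1∣ a

coprime-∣-part : ∀ a {x y} → Coprime x y → Coprime (∣-part a x) (∣-part a y)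
coprime-∣-part a {x} {y} x⊥y with x ∣? a | y ∣? a
... | yes _ | yes _ = x⊥y
... | yes _ | no  _ = Coprime.sym (1-coprimeTo x)
... | no  _ | _     = 1-coprimeTo _

coprime-∤-part : ∀ a q → (¬ q ∣ a → Coprime a q) → Coprime a (∤-part a q)
coprime-∤-part a q q∤a⇒a⊥q with q ∣? a
... | yes _ = Coprime.sym (1-coprimeTo a)
... | no q∤a = q∤a⇒a⊥q q∤a

bFactor≡∏∣-part : ∀ k (p α : Fin k → ℕ) a → bFactor k p α a ≡ ∏ k (λ j → ∣-part a (p j ^ α j))
bFactor≡∏∣-part zero p α a = refl
bFactor≡∏∣-part (suc k) p α a with p Fin.zero ^ α Fin.zero ∣? a
... | yes _ = cong (p Fin.zero ^ α Fin.zero *_) (bFactor≡∏∣-part k (p ∘ Fin.suc) (α ∘ Fin.suc) a)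
... | no  _ = cong (1 *_) (bFactor≡∏∣-part k (p ∘ Fin.suc) (α ∘ Fin.suc) a)

module _ (k : ℕ) (q : Fin k → ℕ) (a : ℕ) where

  ∏∣-part*∏∤-part : ∏ k (∣-part a ∘ q) * ∏ k (∤-part a ∘ q) ≡ ∏ k q
  ∏∣-part*∏∤-part = trans (∏-distrib-* k _ _) (∏-cong k (λ j → ∣-part*∤-part a (q j)))

  ∏∣-part∣ : (∀ i j → i ≢ j → Coprime (q i) (q j)) → ∏ k (∣-part a ∘ q) ∣ a
  ∏∣-part∣ q-coprime = ∏-∣ k _ (λ i j i≢j → coprime-∣-part a (q-coprime i j i≢j)) (∣-part∣ a ∘ q)

  coprime-∏∤-part : (∀ j → ¬ q j ∣ a → Coprime a (q j)) → Coprime a (∏ k (∤-part a ∘ q))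
  coprime-∏∤-part a⊥q = coprime-∏ʳ k _ (λ j → coprime-∤-part a (q j) (a⊥q j))

-- From a ≡ a^(m+2) = a · a^(m+1) we get p^α ∣ a (a^(m+1) − 1), and p ∣ a makes a^(m+1) − 1 prime to p.
GP∧p∣⇒p^α∣ : ∀ {n} .{{_ : NonZero n}} {a p} α → Prime p → p ^ α ∣ n → GP n a → p ∣ a → p ^ α ∣ a
GP∧p∣⇒p^α∣ {a = zero} α _ _ _ _ = _ ∣0
GP∧p∣⇒p^α∣ {a = suc _} α pp p^α∣n (_ , zero , () , _) p∣a
GP∧p∣⇒p^α∣ {a = suc _} α pp p^α∣n (_ , suc zero , s≤s () , _) p∣a
GP∧p∣⇒p^α∣ {n} {a@(suc _)} {p} α pp p^α∣n (_ , suc (suc m) , _ , a^m≡a) p∣a =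
  coprime-divisor (coprime-^ˡ (prime∤⇒coprime pp p∤t∸1) α) p^α∣[t∸1]*a
  where
  instance
    p≢0 : NonZero p
    p≢0 = prime⇒nonZero pp
    p^α≢0 : NonZero (p ^ α)
    p^α≢0 = m^n≢0 p α
  t : ℕ
  t = a ^ suc m
  p^α∣[t∸1]*a : p ^ α ∣ (t ∸ 1) * a
  p^α∣[t∸1]*a = subst (p ^ α ∣_) a*t∸a≡[t∸1]*a (≡mod⇒∣∸ (≡mod-divisor p^α∣n a^m≡a))
    where
    a*t∸a≡[t∸1]*a : a * t ∸ a ≡ (t ∸ 1) * a
    a*t∸a≡[t∸1]*a =
      trans (cong (a * t ∸_) (sym (*-identityʳ a))) (trans (sym (*-distribˡ-∸ a t 1)) (*-comm a (t ∸ 1)))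
  p∤t∸1 : ¬ p ∣ t ∸ 1
  p∤t∸1 p∣t∸1 = nonTrivial⇒≢1 {{prime⇒nonTrivial pp}} (∣1⇒≡1 (∣m+n∣m⇒∣n p∣t∸1+1 p∣t∸1))
    where
    p∣t∸1+1 : p ∣ t ∸ 1 + 1
    p∣t∸1+1 = subst (p ∣_) (sym (m∸n+n≡m (m^n>0 a (suc m)))) (∣m⇒∣m*n (a ^ m) p∣a)

GP∧p^α∤⇒coprime : ∀ {n} .{{_ : NonZero n}} {a p} α →
  Prime p → p ^ α ∣ n → GP n a → ¬ p ^ α ∣ a → Coprime a (p ^ α)
GP∧p^α∤⇒coprime α pp p^α∣n a∈GP p^α∤a =
  Coprime.sym (coprime-^ˡ (prime∤⇒coprime pp (p^α∤a ∘ GP∧p∣⇒p^α∣ α pp p^α∣n a∈GP)) α)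

module _ {n a b c e : ℕ} .{{_ : NonZero n}} .{{_ : NonZero b}} .{{_ : NonZero c}}
         (b*c≡n : b * c ≡ n) (b∣a : b ∣ a) (a⊥c : Coprime a c) (a<n : a < n) (a∉P : ¬ P n a)
         (e<n : e < n) (b∣e : b ∣ e) (e≡1 : e ≡ 1 mod c) where

  private
    b∣n : b ∣ n
    b∣n = divides c (trans (sym b*c≡n) (*-comm b c))

    c∣n : c ∣ n
    c∣n = divides b (sym b*c≡n)

    crt : ∀ {x y} → x ≡ y mod b → x ≡ y mod c → x ≡ y mod n
    crt = chinese-remainder b*c≡n (coprime-∣ˡ b∣a a⊥c)

    e*e≡e : e * e ≡ e mod n
    e*e≡e = crt (∣∧∣⇒≡mod (∣m⇒∣m*n e b∣e) b∣e) (trans (*-cong-≡mod e≡1 e≡1) (sym e≡1))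

    e∈GP : GP n e
    e∈GP = e<n , 2 , ≤-refl , trans (cong (λ z → (e * z) % n) (*-identityʳ e)) e*e≡e

    a≺e : a ≺[ n ] e
    a≺e = inj₂ (crt (∣∧∣⇒≡mod b∣a (∣m⇒∣m*n e b∣a))
                    (trans (cong (_% c) (sym (*-identityʳ a))) (*-cong-≡mod {x = a} refl (sym e≡1))))
        , λ { refl → a∉P (a<n , e*e≡e) }

    a≺y⇒y≡1 : ∀ {y} → a ≺[ n ] y → y ≡ 1 mod c
    a≺y⇒y≡1 (inj₁ a≡y , a≢y) = ⊥-elim (a≢y a≡y)
    a≺y⇒y≡1 (inj₂ a≡ay , _) =
      sym (*-cancelˡ-≡mod a⊥c (trans (cong (_% c) (*-identityʳ a)) (≡mod-divisor c∣n a≡ay)))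

    nothing-between : ∀ y → GP n y → a ≺[ n ] y → y ≺[ n ] e → ⊥
    nothing-between y _ _ (inj₁ y≡e , y≢e) = y≢e y≡e
    nothing-between y (y<n , _) a≺y (inj₂ y≡ye , y≢e) = y≢e (≡mod∧<⇒≡ y<n e<n (crt
      (trans (≡mod-divisor b∣n y≡ye) (∣∧∣⇒≡mod (∣n⇒∣m*n y b∣e) b∣e))
      (trans (a≺y⇒y≡1 a≺y) (sym e≡1))))

    e≼y : ∀ {y} → y ≡ 1 mod c → e ≼[ n ] y
    e≼y y≡1 = inj₂ (crt (∣∧∣⇒≡mod b∣e (∣m⇒∣m*n _ b∣e)) (trans e≡1 (sym (*-cong-≡mod e≡1 y≡1))))

  upperCover-crt : UpperCoverIs n a e
  upperCover-crt = (e∈GP , a≺e , nothing-between) , unique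
    where
    unique : ∀ x → IsUpperCover n a x → x ≡ e
    unique x (_ , a≺x , nothing-between-a-x) with x ≟ e
    ... | yes x≡e = x≡e
    ... | no  x≢e = ⊥-elim (nothing-between-a-x e e∈GP a≺e (e≼y (a≺y⇒y≡1 a≺x) , x≢e ∘ sym))

m∣m^n : ∀ m {n} → n > 0 → m ∣ m ^ n
m∣m^n m {suc n} _ = m∣m*n (m ^ n)

upperCover-euler : ∀ {n a b c} .{{_ : NonZero n}} .{{_ : NonZero b}} .{{_ : NonZero c}} →
  b * c ≡ n → b ∣ a → Coprime a c → a < n → ¬ P n a → UpperCoverIs n a ((b ^ φ c) % n)
upperCover-euler {n} {a} {b} {c} b*c≡n b∣a a⊥c a<n a∉P =
  upperCover-crt b*c≡n b∣a a⊥c a<n a∉P (m%n<n (b ^ φ c) n) b∣e e≡1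
  where
  b∣e : b ∣ (b ^ φ c) % n
  b∣e = %-presˡ-∣ (m∣m^n b (φ>0 c)) (divides c (trans (sym b*c≡n) (*-comm b c)))
  e≡1 : (b ^ φ c) % n ≡ 1 mod c
  e≡1 = trans (m∣n⇒o%n%m≡o%m c n (b ^ φ c) (divides b (sym b*c≡n))) (euler c (coprime-∣ˡ b∣a a⊥c))

unit⇒coprime : ∀ {n a} .{{_ : NonZero n}} → 1 < n → Unit n a → Coprime a n
unit⇒coprime 1<n (w , aw≡1) {d} (d∣a , d∣n) =
  ∣1⇒≡1 (subst (d ∣_) (trans aw≡1 (m<n⇒m%n≡m 1<n)) (%-presˡ-∣ (∣m⇒∣m*n w d∣a) d∣n))

*-div-cancelˡ : ∀ b c .{{_ : NonZero b}} → (b * c) div b ≡ c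
*-div-cancelˡ (suc b) c = trans (cong (_/ suc b) (*-comm (suc b) c)) (m*n/n≡m c (suc b))

-- The exponents αᵢ need not be positive, and for a unit the second formula also holds (then b = 1).
theorem2p4 : (n : ℕ) .{{_ : NonZero n}} → 1 < n →
    (k : ℕ) (p α : Fin k → ℕ) →
    ((i : Fin k) → Prime (p i)) →
    ((i j : Fin k) → p i ≡ p j → i ≡ j) →
    ((i : Fin k) → 0 < α i) →
    n ≡ ∏ k (λ i → p i ^ α i) →
    (a : ℕ) → GP n a → ¬ P n a →
    (Unit n a → UpperCoverIs n a 1) ×
    (¬ Unit n a →
      UpperCoverIs n a ((bFactor k p α a ^ φ (n div bFactor k p α a)) % n))
theorem2p4 n 1<n k p α prime distinct _ n≡∏ a a∈GP@(a<n , _) a∉P = unit-case , λ _ → non-unit-case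
  where
  unit-case : Unit n a → UpperCoverIs n a 1
  unit-case unit = upperCover-crt (*-identityˡ n) (1∣ a) (unit⇒coprime 1<n unit) a<n a∉P 1<n (1∣ 1) refl

  q : Fin k → ℕ
  q j = p j ^ α j
  B C : ℕ
  B = ∏ k (∣-part a ∘ q)
  C = ∏ k (∤-part a ∘ q)
  B*C≡n : B * C ≡ n
  B*C≡n = trans (∏∣-part*∏∤-part k q a) (sym n≡∏)
  B*C≢0 : NonZero (B * C)
  B*C≢0 = subst NonZero (sym B*C≡n) (>-nonZero (m<n⇒0<n 1<n))
  instance
    B≢0 : NonZero B
    B≢0 = m*n≢0⇒m≢0 B {{B*C≢0}}
    C≢0 : NonZero C
    C≢0 = m*n≢0⇒n≢0 B {{B*C≢0}}
  n/B≡C : n div B ≡ C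
  n/B≡C = trans (cong (_div B) (sym B*C≡n)) (*-div-cancelˡ B C)
  B∣a : B ∣ a
  B∣a = ∏∣-part∣ k q a λ i j i≢j →
    coprime-^ (distinct-primes⇒coprime (prime i) (prime j) (i≢j ∘ distinct i j)) (α i) (α j)
  a⊥C : Coprime a C
  a⊥C = coprime-∏∤-part k q a λ j →
    GP∧p^α∤⇒coprime (α j) (prime j) (subst (q j ∣_) (sym n≡∏) (∣-∏ k q j)) a∈GP

  non-unit-case : UpperCoverIs n a ((bFactor k p α a ^ φ (n div bFactor k p α a)) % n)
  non-unit-case rewrite bFactor≡∏∣-part k p α a | n/B≡C = upperCover-euler B*C≡n B∣a a⊥C a<n a∉P
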